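{- Let $\mathbb{K}=\mathbb{R}$ or $\mathbb{C}$ and let $h,f\in\mathcal{F}_1$. For $u\in\mathcal{F}_1$ put $A_u(z)=z/\bar u(z)$, where $\bar u$ is the compositional inverse of $u$. Then $h\circ f=f\circ h$ if and only if \[ A_f(z)\,A_h\!\left(\frac{z}{A_f(z)}\right)=A_h(z)\,A_f\!\left(\frac{z}{A_h(z)}\right). \] Moreover, $h\circ f=f\circ h=z$ if and only if \[ A_f(z)\,A_h\!\left(\frac{z}{A_f(z)}\right)=A_h(z)\,A_f\!\left(\frac{z}{A_h(z)}\right)=1. \]
   Context: $\mathcal{F}=\mathbb{K}[[z]]$ is the ring of formal power series over $\mathbb{K}$; $\mathcal{F}_r$ denotes the set of formal power series of order $r$ (least index of a nonzero coefficient equals $r$). For $u\in\mathcal{F}_1$, $\bar u$ denotes its compositional inverse, $u(\bar u(z))=\bar u(u(z))=z$, and $(h\circ f)(z)=h(f(z))$. -}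

module Defs where

open import Level using (Level; _⊔_)
open import Data.Nat using (ℕ; zero; suc; _∸_)
open import Data.Product using (_×_; Σ-syntax)
open import Relation.Nullary using (¬_)
open import Algebra.Bundles using (CommutativeRing)

IsField : ∀ {c ℓ} → CommutativeRing c ℓ → Set (c ⊔ ℓ)
IsField K = ¬ (1# ≈ 0#) × (∀ x → ¬ (x ≈ 0#) → Σ[ y ∈ Carrier ] (x * y ≈ 1#))
  where open CommutativeRing K

module FPS {c ℓ} (K : CommutativeRing c ℓ) where
  open CommutativeRing K

  Series : Set c
  Series = ℕ → Carrier

  infix 4 _≋_
  _≋_ : Series → Series → Set ℓ
  f ≋ g = ∀ n → f n ≈ g n

  Σ≤ : ℕ → (ℕ → Carrier) → Carrier
  Σ≤ zero F = F 0
  Σ≤ (suc n) F = Σ≤ n F + F (suc n)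

  one : Series
  one zero = 1#
  one (suc _) = 0#

  X : Series
  X 1 = 1#
  X _ = 0#

  infixl 7 _·_
  _·_ : Series → Series → Series
  (f · g) n = Σ≤ n (λ i → f i * g (n ∸ i))

  pow : Series → ℕ → Series
  pow u zero = one
  pow u (suc k) = u · pow u k

  -- composition g ∘ u  (meaningful for u of order ≥ 1):
  -- [z^n] g(u(z)) = Σ_{k=0}^{n} g_k [z^n] u(z)^k
  compose : Series → Series → Series
  compose g u n = Σ≤ n (λ k → g k * pow u k n)

  Order1 : Series → Set ℓ
  Order1 u = (u 0 ≈ 0#) × ¬ (u 1 ≈ 0#)

  IsCompInv : Series → Series → Set ℓ
  IsCompInv u ū = Order1 ū × (compose u ū ≋ X) × (compose ū u ≋ X)

  IsQuot : Series → Series → Series → Set ℓ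
  IsQuot q a b = q · b ≋ a

-- Since A_u · ū = z and z / A_p = p̄, the left-hand side A_p(z) · A_q(z / A_p(z)) is
-- z / (q̄ ∘ p̄), i.e. A_{p ∘ q}; so the identity compares A_{f ∘ h} with A_{h ∘ f}. As A_u
-- has a unit constant term it determines ū, and ū determines u, so the identity holds
-- iff f ∘ h = h ∘ f. Likewise A_{h ∘ f} = 1 iff the inverse of h ∘ f is z iff h ∘ f = z.
module Submission where

open import Defs
open import Algebra.Bundles using (CommutativeRing)
open import Data.Empty using (⊥-elim)
open import Data.Nat using (ℕ; zero; suc; _∸_; _≤_; _<_; z≤n; s≤s)
open import Data.Nat using () renaming (_+_ to _+ℕ_)
open import Data.Nat.Properties
  using ( ≤-refl; m≤n⇒m≤1+n; m≤n⇒m<n∨m≡n; m<1+n⇒m≤n; <⇒≢; >⇒≢; ≤-<-trans; +-monoʳ-<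
        ; m∸n≤m; n∸n≡0; m≤n+m∸n; m+[n∸m]≡n; m∸[m∸n]≡n; +-∸-assoc; ∸-+-assoc )
open import Data.Product using (_×_; _,_)
open import Data.Sum using (inj₁; inj₂)
open import Function.Bundles using (_⇔_; mk⇔; Equivalence)
import Function.Properties.Equivalence as ⇔
open import Relation.Binary.Bundles using (Setoid)
open import Relation.Binary.PropositionalEquality as ≡ using (_≡_; _≢_)

module Sums {c ℓ} (K : CommutativeRing c ℓ) where
  open CommutativeRing K
  open FPS K using (Σ≤)
  open import Algebra.Properties.CommutativeSemigroup +-commutativeSemigroup using (interchange)
  open import Relation.Binary.Reasoning.Setoid setoid

  Σ≤-cong-≤ : ∀ n {F G : ℕ → Carrier} → (∀ i → i ≤ n → F i ≈ G i) → Σ≤ n F ≈ Σ≤ n G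
  Σ≤-cong-≤ zero    F≈G = F≈G 0 z≤n
  Σ≤-cong-≤ (suc n) F≈G =
    +-cong (Σ≤-cong-≤ n (λ i i≤n → F≈G i (m≤n⇒m≤1+n i≤n))) (F≈G (suc n) ≤-refl)

  Σ≤-cong : ∀ n {F G : ℕ → Carrier} → (∀ i → F i ≈ G i) → Σ≤ n F ≈ Σ≤ n G
  Σ≤-cong n F≈G = Σ≤-cong-≤ n (λ i _ → F≈G i)

  Σ≤-distrib-+ : ∀ n F G → Σ≤ n (λ i → F i + G i) ≈ Σ≤ n F + Σ≤ n G
  Σ≤-distrib-+ zero    F G = refl
  Σ≤-distrib-+ (suc n) F G = trans (+-cong (Σ≤-distrib-+ n F G) refl) (interchange _ _ _ _)

  *-distribˡ-Σ≤ : ∀ n a F → a * Σ≤ n F ≈ Σ≤ n (λ i → a * F i)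
  *-distribˡ-Σ≤ zero    a F = refl
  *-distribˡ-Σ≤ (suc n) a F = trans (distribˡ a _ _) (+-cong (*-distribˡ-Σ≤ n a F) refl)

  *-distribʳ-Σ≤ : ∀ n a F → Σ≤ n F * a ≈ Σ≤ n (λ i → F i * a)
  *-distribʳ-Σ≤ zero    a F = refl
  *-distribʳ-Σ≤ (suc n) a F = trans (distribʳ a _ _) (+-cong (*-distribʳ-Σ≤ n a F) refl)

  Σ≤-zero : ∀ n F → (∀ i → i ≤ n → F i ≈ 0#) → Σ≤ n F ≈ 0#
  Σ≤-zero zero    F F≈0 = F≈0 0 z≤n
  Σ≤-zero (suc n) F F≈0 =
    trans (+-cong (Σ≤-zero n F (λ i i≤n → F≈0 i (m≤n⇒m≤1+n i≤n))) (F≈0 (suc n) ≤-refl)) (+-identityˡ 0#)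

  Σ≤-suc : ∀ n F → Σ≤ (suc n) F ≈ F 0 + Σ≤ n (λ i → F (suc i))
  Σ≤-suc zero    F = refl
  Σ≤-suc (suc n) F = trans (+-cong (Σ≤-suc n F) refl) (+-assoc _ _ _)

  Σ≤-reverse : ∀ n F → Σ≤ n F ≈ Σ≤ n (λ i → F (n ∸ i))
  Σ≤-reverse zero    F = refl
  Σ≤-reverse (suc n) F = begin
    Σ≤ n F + F (suc n)                  ≈⟨ +-cong (Σ≤-reverse n F) refl ⟩
    Σ≤ n (λ i → F (n ∸ i)) + F (suc n)  ≈⟨ +-comm _ _ ⟩
    F (suc n) + Σ≤ n (λ i → F (n ∸ i))  ≈⟨ Σ≤-suc n (λ i → F (suc n ∸ i)) ⟨
    Σ≤ (suc n) (λ i → F (suc n ∸ i))    ∎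

  Σ≤-comm : ∀ n m (F : ℕ → ℕ → Carrier) →
            Σ≤ n (λ i → Σ≤ m (F i)) ≈ Σ≤ m (λ j → Σ≤ n (λ i → F i j))
  Σ≤-comm zero    m F = refl
  Σ≤-comm (suc n) m F = trans (+-cong (Σ≤-comm n m F) refl) (sym (Σ≤-distrib-+ m _ _))

  Σ≤-single : ∀ n F j → j ≤ n → (∀ i → i ≢ j → F i ≈ 0#) → Σ≤ n F ≈ F j
  Σ≤-single zero    F .0 z≤n _ = refl
  Σ≤-single (suc n) F j j≤1+n F≈0 with m≤n⇒m<n∨m≡n j≤1+n
  ... | inj₁ j<1+n = trans (+-cong (Σ≤-single n F j (m<1+n⇒m≤n j<1+n) F≈0) (F≈0 (suc n) (>⇒≢ j<1+n)))
                           (+-identityʳ _)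
  ... | inj₂ ≡.refl =
    trans (+-cong (Σ≤-zero n F (λ i i≤n → F≈0 i (<⇒≢ (s≤s i≤n)))) refl) (+-identityˡ _)

  Σ≤-extend : ∀ n m F → n ≤ m → (∀ i → n < i → F i ≈ 0#) → Σ≤ m F ≈ Σ≤ n F
  Σ≤-extend n zero    F z≤n _ = refl
  Σ≤-extend n (suc m) F n≤1+m F≈0 with m≤n⇒m<n∨m≡n n≤1+m
  ... | inj₁ n<1+m = trans (+-cong (Σ≤-extend n m F (m<1+n⇒m≤n n<1+m) F≈0) (F≈0 (suc m) n<1+m))
                           (+-identityʳ _)
  ... | inj₂ ≡.refl = refl

  Σ≤-triangle : ∀ n (F : ℕ → ℕ → Carrier) →
    Σ≤ n (λ k → Σ≤ k (λ i → F i (k ∸ i))) ≈ Σ≤ n (λ i → Σ≤ (n ∸ i) (F i))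
  Σ≤-triangle zero    F = refl
  Σ≤-triangle (suc n) F = begin
    Σ≤ n (λ k → Σ≤ k (λ i → F i (k ∸ i))) + (Σ≤ n (λ i → F i (suc n ∸ i)) + F (suc n) (n ∸ n))
      ≈⟨ +-cong (Σ≤-triangle n F) (+-cong (Σ≤-cong-≤ n (λ i i≤n → reflexive (≡.cong (F i) (∸-suc i≤n)))) refl) ⟩
    Σ≤ n (λ i → Σ≤ (n ∸ i) (F i)) + (Σ≤ n (λ i → F i (suc (n ∸ i))) + F (suc n) (n ∸ n))
      ≈⟨ +-assoc _ _ _ ⟨
    (Σ≤ n (λ i → Σ≤ (n ∸ i) (F i)) + Σ≤ n (λ i → F i (suc (n ∸ i)))) + F (suc n) (n ∸ n)
      ≈⟨ +-cong (Σ≤-distrib-+ n _ _) (last (n∸n≡0 n)) ⟨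
    Σ≤ n (λ i → Σ≤ (suc (n ∸ i)) (F i)) + Σ≤ (n ∸ n) (F (suc n))
      ≈⟨ +-cong (Σ≤-cong-≤ n (λ i i≤n → reflexive (≡.cong (λ k → Σ≤ k (F i)) (∸-suc i≤n)))) refl ⟨
    Σ≤ n (λ i → Σ≤ (suc n ∸ i) (F i)) + Σ≤ (suc n ∸ suc n) (F (suc n)) ∎
    where
    ∸-suc : ∀ {i} → i ≤ n → suc n ∸ i ≡ suc (n ∸ i)
    ∸-suc = +-∸-assoc 1
    last : ∀ {G : ℕ → Carrier} {k} → k ≡ 0 → Σ≤ k G ≈ G k
    last ≡.refl = refl

module SeriesRing {c ℓ} (K : CommutativeRing c ℓ) where
  open CommutativeRing K
  open FPS K
  open Sums K
  open import Relation.Binary.Reasoning.Setoid setoid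

  ≋-refl : ∀ {a} → a ≋ a
  ≋-refl n = refl

  ≋-sym : ∀ {a b} → a ≋ b → b ≋ a
  ≋-sym a≋b n = sym (a≋b n)

  ≋-trans : ∀ {a b d} → a ≋ b → b ≋ d → a ≋ d
  ≋-trans a≋b b≋d n = trans (a≋b n) (b≋d n)

  ≋-setoid : Setoid c ℓ
  ≋-setoid = record
    { Carrier = Series ; _≈_ = _≋_
    ; isEquivalence = record { refl = ≋-refl ; sym = ≋-sym ; trans = ≋-trans } }

  ·-cong : ∀ {a a′ b b′} → a ≋ a′ → b ≋ b′ → a · b ≋ a′ · b′
  ·-cong a≋a′ b≋b′ n = Σ≤-cong n (λ i → *-cong (a≋a′ i) (b≋b′ (n ∸ i)))

  ·-comm : ∀ a b → a · b ≋ b · a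
  ·-comm a b n = trans (Σ≤-reverse n _) (Σ≤-cong-≤ n (λ i i≤n →
    trans (*-comm _ _) (*-cong (reflexive (≡.cong b (m∸[m∸n]≡n i≤n))) refl)))

  ·-identityˡ : ∀ a → one · a ≋ a
  ·-identityˡ a n = trans (Σ≤-single n _ 0 z≤n vanish) (*-identityˡ _)
    where
    vanish : ∀ i → i ≢ 0 → one i * a (n ∸ i) ≈ 0#
    vanish zero    i≢0 = ⊥-elim (i≢0 ≡.refl)
    vanish (suc i) _   = zeroˡ _

  ·-identityʳ : ∀ a → a · one ≋ a
  ·-identityʳ a = ≋-trans (·-comm a one) (·-identityˡ a)

  ·-assoc : ∀ a b d → (a · b) · d ≋ a · (b · d)
  ·-assoc a b d n = begin
    Σ≤ n (λ m → Σ≤ m (λ i → a i * b (m ∸ i)) * d (n ∸ m))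
      ≈⟨ Σ≤-cong n (λ m → *-distribʳ-Σ≤ m _ _) ⟩
    Σ≤ n (λ m → Σ≤ m (λ i → a i * b (m ∸ i) * d (n ∸ m)))
      ≈⟨ Σ≤-cong n (λ m → Σ≤-cong-≤ m (λ i i≤m →
           *-cong refl (reflexive (≡.cong (λ k → d (n ∸ k)) (≡.sym (m+[n∸m]≡n i≤m)))))) ⟩
    Σ≤ n (λ m → Σ≤ m (λ i → G i (m ∸ i)))
      ≈⟨ Σ≤-triangle n G ⟩
    Σ≤ n (λ i → Σ≤ (n ∸ i) (G i))
      ≈⟨ Σ≤-cong n (λ i → Σ≤-cong (n ∸ i) (λ j → trans (*-assoc _ _ _)
           (*-cong refl (*-cong refl (reflexive (≡.cong d (≡.sym (∸-+-assoc n i j)))))))) ⟩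
    Σ≤ n (λ i → Σ≤ (n ∸ i) (λ j → a i * (b j * d (n ∸ i ∸ j))))
      ≈⟨ Σ≤-cong n (λ i → *-distribˡ-Σ≤ (n ∸ i) _ _) ⟨
    Σ≤ n (λ i → a i * Σ≤ (n ∸ i) (λ j → b j * d (n ∸ i ∸ j))) ∎
    where
    G : ℕ → ℕ → Carrier
    G i j = a i * b j * d (n ∸ (i +ℕ j))

  pow-cong : ∀ {a b} → a ≋ b → ∀ k → pow a k ≋ pow b k
  pow-cong a≋b zero    = ≋-refl
  pow-cong a≋b (suc k) = ·-cong a≋b (pow-cong a≋b k)

  pow-+ : ∀ u i j → pow u (i +ℕ j) ≋ pow u i · pow u j
  pow-+ u zero    j = ≋-sym (·-identityˡ _)
  pow-+ u (suc i) j = ≋-trans (·-cong ≋-refl (pow-+ u i j)) (≋-sym (·-assoc u (pow u i) (pow u j)))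

  pow-vanish : ∀ u → u 0 ≈ 0# → ∀ k n → n < k → pow u k n ≈ 0#
  pow-vanish u u₀≈0 (suc k) n (s≤s n≤k) = Σ≤-zero n _ vanish
    where
    vanish : ∀ i → i ≤ n → u i * pow u k (n ∸ i) ≈ 0#
    vanish zero    _          = trans (*-cong u₀≈0 refl) (zeroˡ _)
    vanish (suc i) (s≤s i≤n) =
      trans (*-cong refl (pow-vanish u u₀≈0 k _ (≤-<-trans (m∸n≤m _ i) n≤k))) (zeroʳ _)

  X·-suc : ∀ a n → (X · a) (suc n) ≈ a n
  X·-suc a n = trans (Σ≤-single (suc n) _ 1 (s≤s z≤n) vanish) (*-identityˡ _)
    where
    vanish : ∀ i → i ≢ 1 → X i * a (suc n ∸ i) ≈ 0#
    vanish zero          _   = zeroˡ _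
    vanish (suc zero)    i≢1 = ⊥-elim (i≢1 ≡.refl)
    vanish (suc (suc i)) _   = zeroˡ _

  X·-injective : ∀ {a b} → X · a ≋ X · b → a ≋ b
  X·-injective {a} {b} Xa≋Xb n = trans (sym (X·-suc a n)) (trans (Xa≋Xb (suc n)) (X·-suc b n))

  pow-X-diagonal : ∀ n → pow X n n ≈ 1#
  pow-X-diagonal zero    = refl
  pow-X-diagonal (suc n) = trans (X·-suc (pow X n) n) (pow-X-diagonal n)

  pow-X-off-diagonal : ∀ k n → k ≢ n → pow X k n ≈ 0#
  pow-X-off-diagonal zero    zero    k≢n = ⊥-elim (k≢n ≡.refl)
  pow-X-off-diagonal zero    (suc n) _   = refl
  pow-X-off-diagonal (suc k) zero    _   = zeroˡ _
  pow-X-off-diagonal (suc k) (suc n) k≢n =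
    trans (X·-suc (pow X k) n) (pow-X-off-diagonal k n (λ k≡n → k≢n (≡.cong suc k≡n)))

module Composition {c ℓ} (K : CommutativeRing c ℓ) where
  open CommutativeRing K
  open FPS K
  open Sums K
  open SeriesRing K
  open import Algebra.Properties.CommutativeSemigroup *-commutativeSemigroup
    using () renaming (interchange to *-interchange)
  open import Relation.Binary.Reasoning.Setoid setoid

  compose-0≈0 : ∀ g u → g 0 ≈ 0# → compose g u 0 ≈ 0#
  compose-0≈0 g u g₀≈0 = trans (*-identityʳ _) g₀≈0

  compose-congˡ : ∀ {g g′} u → g ≋ g′ → compose g u ≋ compose g′ u
  compose-congˡ u g≋g′ n = Σ≤-cong n (λ k → *-cong (g≋g′ k) refl)

  compose-congʳ : ∀ g {u v} → u ≋ v → compose g u ≋ compose g v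
  compose-congʳ g u≋v n = Σ≤-cong n (λ k → *-cong refl (pow-cong u≋v k n))

  X-compose : ∀ u → u 0 ≈ 0# → compose X u ≋ u
  X-compose u u₀≈0 zero    = trans (zeroˡ _) (sym u₀≈0)
  X-compose u u₀≈0 (suc n) =
    trans (Σ≤-single (suc n) _ 1 (s≤s z≤n) vanish) (trans (*-identityˡ _) (·-identityʳ u (suc n)))
    where
    vanish : ∀ i → i ≢ 1 → X i * pow u i (suc n) ≈ 0#
    vanish zero          _   = zeroˡ _
    vanish (suc zero)    i≢1 = ⊥-elim (i≢1 ≡.refl)
    vanish (suc (suc i)) _   = zeroˡ _

  compose-X : ∀ g → compose g X ≋ g
  compose-X g n =
    trans (Σ≤-single n _ n ≤-refl (λ k k≢n → trans (*-cong refl (pow-X-off-diagonal k n k≢n)) (zeroʳ _)))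
          (trans (*-cong refl (pow-X-diagonal n)) (*-identityʳ _))

  one-compose : ∀ u → compose one u ≋ one
  one-compose u n = trans (Σ≤-single n _ 0 z≤n vanish) (*-identityˡ _)
    where
    vanish : ∀ i → i ≢ 0 → one i * pow u i n ≈ 0#
    vanish zero    i≢0 = ⊥-elim (i≢0 ≡.refl)
    vanish (suc i) _   = zeroˡ _

  compose-extend : ∀ g u → u 0 ≈ 0# → ∀ n N → n ≤ N → compose g u n ≈ Σ≤ N (λ k → g k * pow u k n)
  compose-extend g u u₀≈0 n N n≤N =
    sym (Σ≤-extend n N _ n≤N (λ k n<k → trans (*-cong refl (pow-vanish u u₀≈0 k n n<k)) (zeroʳ _)))

  compose-· : ∀ a b u → u 0 ≈ 0# → compose (a · b) u ≋ compose a u · compose b u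
  compose-· a b u u₀≈0 n = begin
    Σ≤ n (λ k → Σ≤ k (λ i → a i * b (k ∸ i)) * pow u k n)
      ≈⟨ Σ≤-cong n (λ k → *-distribʳ-Σ≤ k _ _) ⟩
    Σ≤ n (λ k → Σ≤ k (λ i → a i * b (k ∸ i) * pow u k n))
      ≈⟨ Σ≤-cong n (λ k → Σ≤-cong-≤ k (λ i i≤k →
           *-cong refl (reflexive (≡.cong (λ m → pow u m n) (≡.sym (m+[n∸m]≡n i≤k)))))) ⟩
    Σ≤ n (λ k → Σ≤ k (λ i → G i (k ∸ i)))
      ≈⟨ Σ≤-triangle n G ⟩
    Σ≤ n (λ i → Σ≤ (n ∸ i) (G i))
      ≈⟨ Σ≤-cong n (λ i → Σ≤-extend (n ∸ i) n (G i) (m∸n≤m n i) (λ j n∸i<j →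
           trans (*-cong refl (pow-vanish u u₀≈0 (i +ℕ j) n (≤-<-trans (m≤n+m∸n n i) (+-monoʳ-< i n∸i<j))))
                 (zeroʳ _))) ⟨
    Σ≤ n (λ i → Σ≤ n (G i))
      ≈⟨ Σ≤-cong n (λ i → Σ≤-cong n (λ j → trans (*-cong refl (pow-+ u i j n)) (*-distribˡ-Σ≤ n _ _))) ⟩
    Σ≤ n (λ i → Σ≤ n (λ j → Σ≤ n (λ m → a i * b j * (pow u i m * pow u j (n ∸ m)))))
      ≈⟨ Σ≤-cong n (λ i → Σ≤-cong n (λ j → Σ≤-cong n (λ m → *-interchange _ _ _ _))) ⟩
    Σ≤ n (λ i → Σ≤ n (λ j → Σ≤ n (λ m → H m i j)))
      ≈⟨ Σ≤-cong n (λ i → Σ≤-comm n n (λ j m → H m i j)) ⟩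
    Σ≤ n (λ i → Σ≤ n (λ m → Σ≤ n (λ j → H m i j)))
      ≈⟨ Σ≤-comm n n (λ i m → Σ≤ n (λ j → H m i j)) ⟩
    Σ≤ n (λ m → Σ≤ n (λ i → Σ≤ n (λ j → H m i j)))
      ≈⟨ Σ≤-cong n (λ m → trans (*-distribʳ-Σ≤ n _ _) (Σ≤-cong n (λ i → *-distribˡ-Σ≤ n _ _))) ⟨
    Σ≤ n (λ m → Σ≤ n (λ i → a i * pow u i m) * Σ≤ n (λ j → b j * pow u j (n ∸ m)))
      ≈⟨ Σ≤-cong-≤ n (λ m m≤n →
           *-cong (compose-extend a u u₀≈0 m n m≤n) (compose-extend b u u₀≈0 (n ∸ m) n (m∸n≤m n m))) ⟨
    Σ≤ n (λ m → compose a u m * compose b u (n ∸ m)) ∎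
    where
    G : ℕ → ℕ → Carrier
    G i j = a i * b j * pow u (i +ℕ j) n
    H : ℕ → ℕ → ℕ → Carrier
    H m i j = a i * pow u i m * (b j * pow u j (n ∸ m))

  compose-pow : ∀ g u → u 0 ≈ 0# → ∀ k → compose (pow g k) u ≋ pow (compose g u) k
  compose-pow g u u₀≈0 zero    = one-compose u
  compose-pow g u u₀≈0 (suc k) =
    ≋-trans (compose-· g (pow g k) u u₀≈0) (·-cong ≋-refl (compose-pow g u u₀≈0 k))

  compose-assoc : ∀ g u v → u 0 ≈ 0# → v 0 ≈ 0# → compose g (compose u v) ≋ compose (compose g u) v
  compose-assoc g u v u₀≈0 v₀≈0 n = begin
    Σ≤ n (λ k → g k * pow (compose u v) k n)
      ≈⟨ Σ≤-cong n (λ k → *-cong refl (compose-pow u v v₀≈0 k n)) ⟨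
    Σ≤ n (λ k → g k * Σ≤ n (λ j → pow u k j * pow v j n))
      ≈⟨ Σ≤-cong n (λ k → *-distribˡ-Σ≤ n _ _) ⟩
    Σ≤ n (λ k → Σ≤ n (λ j → g k * (pow u k j * pow v j n)))
      ≈⟨ Σ≤-comm n n _ ⟩
    Σ≤ n (λ j → Σ≤ n (λ k → g k * (pow u k j * pow v j n)))
      ≈⟨ Σ≤-cong n (λ j → trans (*-distribʳ-Σ≤ n _ _) (Σ≤-cong n (λ k → *-assoc _ _ _))) ⟨
    Σ≤ n (λ j → Σ≤ n (λ k → g k * pow u k j) * pow v j n)
      ≈⟨ Σ≤-cong-≤ n (λ j j≤n → *-cong (compose-extend g u u₀≈0 j n j≤n) refl) ⟨
    Σ≤ n (λ j → compose g u j * pow v j n) ∎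

module Cancellation {c ℓ} (K : CommutativeRing c ℓ) where
  open CommutativeRing K
  open FPS K
  open Sums K
  open SeriesRing K
  open import Algebra.Properties.Group +-group using () renaming (∙-cancelˡ to +-cancelˡ)
  open import Relation.Binary.Reasoning.Setoid setoid

  *-cancelʳ-unit : ∀ {b y x z} → b * y ≈ 1# → x * b ≈ z * b → x ≈ z
  *-cancelʳ-unit {b} {y} {x} {z} by≈1 xb≈zb = begin
    x            ≈⟨ *-identityʳ x ⟨
    x * 1#       ≈⟨ *-cong refl by≈1 ⟨
    x * (b * y)  ≈⟨ *-assoc _ _ _ ⟨
    x * b * y    ≈⟨ *-cong xb≈zb refl ⟩
    z * b * y    ≈⟨ *-assoc _ _ _ ⟩
    z * (b * y)  ≈⟨ *-cong refl by≈1 ⟩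
    z * 1#       ≈⟨ *-identityʳ z ⟩
    z            ∎

  -- Coefficient n of a · b determines a n once a 0, …, a (n - 1) are known.
  ·-cancelʳ-unit : ∀ {a b d} y → b 0 * y ≈ 1# → a · b ≋ d · b → a ≋ d
  ·-cancelʳ-unit {a} {b} {d} y b₀y≈1 ab≋db n = agree n n ≤-refl
    where
    agree : ∀ n i → i ≤ n → a i ≈ d i
    agree zero    .0 z≤n    = *-cancelʳ-unit b₀y≈1 (ab≋db 0)
    agree (suc n) i  i≤1+n with m≤n⇒m<n∨m≡n i≤1+n
    ... | inj₁ i<1+n  = agree n i (m<1+n⇒m≤n i<1+n)
    ... | inj₂ ≡.refl = *-cancelʳ-unit b₀y≈1 (trans (*-cong refl (sym bₙ∸ₙ≈b₀))
                          (trans leading (*-cong refl bₙ∸ₙ≈b₀)))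
      where
      bₙ∸ₙ≈b₀ : b (n ∸ n) ≈ b 0
      bₙ∸ₙ≈b₀ = reflexive (≡.cong b (n∸n≡0 n))
      lower : Σ≤ n (λ j → a j * b (suc n ∸ j)) ≈ Σ≤ n (λ j → d j * b (suc n ∸ j))
      lower = Σ≤-cong-≤ n (λ j j≤n → *-cong (agree n j j≤n) refl)
      leading : a (suc n) * b (n ∸ n) ≈ d (suc n) * b (n ∸ n)
      leading = +-cancelˡ _ _ _ (trans (+-cong (sym lower) refl) (ab≋db (suc n)))

  shift : Series → Series
  shift b n = b (suc n)

  X·shift : ∀ b → b 0 ≈ 0# → X · shift b ≋ b
  X·shift b b₀≈0 zero    = trans (zeroˡ _) (sym b₀≈0)
  X·shift b b₀≈0 (suc n) = X·-suc (shift b) n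

  ·-cancelʳ-order1 : ∀ {a b d} y → b 0 ≈ 0# → b 1 * y ≈ 1# → a · b ≋ d · b → a ≋ d
  ·-cancelʳ-order1 {a} {b} {d} y b₀≈0 b₁y≈1 ab≋db =
    ·-cancelʳ-unit {b = shift b} y b₁y≈1
      (X·-injective (≋-trans (≋-sym (pull-X a)) (≋-trans ab≋db (pull-X d))))
    where
    pull-X : ∀ a → a · b ≋ X · (a · shift b)
    pull-X a = ≋-trans (·-cong ≋-refl (≋-sym (X·shift b b₀≈0)))
               (≋-trans (≋-sym (·-assoc a X (shift b)))
               (≋-trans (·-cong (·-comm a X) (≋-refl {shift b})) (·-assoc X a (shift b))))

  quot-X-leading : ∀ {A T} → IsQuot A X T → T 0 ≈ 0# → A 0 * T 1 ≈ 1#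
  quot-X-leading {A} {T} AT≋X T₀≈0 = begin
    A 0 * T 1              ≈⟨ +-identityʳ _ ⟨
    A 0 * T 1 + 0#         ≈⟨ +-cong refl (trans (*-cong refl T₀≈0) (zeroʳ _)) ⟨
    A 0 * T 1 + A 1 * T 0  ≈⟨ AT≋X 1 ⟩
    1#                     ∎

module Inversion {c ℓ} (K : CommutativeRing c ℓ) where
  open CommutativeRing K using (_≈_; 0#; *-comm; trans)
  open FPS K
  open SeriesRing K
  open Composition K
  open Cancellation K
  open import Relation.Binary.Reasoning.Setoid ≋-setoid

  quot-X-unique : ∀ {w A ū} → IsQuot w X A → IsQuot A X ū → ū 0 ≈ 0# → w ≋ ū
  quot-X-unique {w} {A} {ū} wA≋X Aū≋X ū₀≈0 =
    ·-cancelʳ-unit {w} {A} {ū} (ū 1) (quot-X-leading {A} {ū} Aū≋X ū₀≈0) (begin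
      w · A  ≈⟨ wA≋X ⟩
      X      ≈⟨ Aū≋X ⟨
      A · ū  ≈⟨ ·-comm A ū ⟩
      ū · A  ∎)

  quot-X-cong⇔ : ∀ {A B T S} → IsQuot A X T → IsQuot B X S → T 0 ≈ 0# → (A ≋ B ⇔ T ≋ S)
  quot-X-cong⇔ {A} {B} {T} {S} AT≋X BS≋X T₀≈0 = mk⇔ to from
    where
    to : A ≋ B → T ≋ S
    to A≋B = ·-cancelʳ-unit {T} {A} {S} (T 1) (quot-X-leading {A} {T} AT≋X T₀≈0) (begin
      T · A  ≈⟨ ·-comm T A ⟩
      A · T  ≈⟨ AT≋X ⟩
      X      ≈⟨ BS≋X ⟨
      B · S  ≈⟨ ·-comm B S ⟩
      S · B  ≈⟨ ·-cong ≋-refl A≋B ⟨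
      S · A  ∎)
    from : T ≋ S → A ≋ B
    from T≋S = ·-cancelʳ-order1 {A} {T} {B} (A 0) T₀≈0
      (trans (*-comm _ _) (quot-X-leading {A} {T} AT≋X T₀≈0)) (begin
      A · T  ≈⟨ AT≋X ⟩
      X      ≈⟨ BS≋X ⟨
      B · S  ≈⟨ ·-cong ≋-refl T≋S ⟨
      B · T  ∎)

  -- A_p(z) · A_q(z / A_p(z)) = z / (q̄ ∘ p̄), because z / A_p(z) = p̄.
  quot-X-compose : ∀ {Ap Aq p̄ q̄ wp} → IsQuot Ap X p̄ → IsQuot Aq X q̄ → IsQuot wp X Ap → p̄ 0 ≈ 0# →
    IsQuot (Ap · compose Aq wp) X (compose q̄ p̄)
  quot-X-compose {Ap} {Aq} {p̄} {q̄} {wp} App̄≋X Aqq̄≋X wpAp≋X p̄₀≈0 = begin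
    (Ap · compose Aq wp) · compose q̄ p̄
      ≈⟨ ·-cong (·-cong (≋-refl {Ap}) (compose-congʳ Aq wp≋p̄)) (≋-refl {compose q̄ p̄}) ⟩
    (Ap · compose Aq p̄) · compose q̄ p̄  ≈⟨ ·-assoc Ap (compose Aq p̄) (compose q̄ p̄) ⟩
    Ap · (compose Aq p̄ · compose q̄ p̄)  ≈⟨ ·-cong ≋-refl (compose-· Aq q̄ p̄ p̄₀≈0) ⟨
    Ap · compose (Aq · q̄) p̄            ≈⟨ ·-cong ≋-refl (compose-congˡ p̄ Aqq̄≋X) ⟩
    Ap · compose X p̄                   ≈⟨ ·-cong ≋-refl (X-compose p̄ p̄₀≈0) ⟩
    Ap · p̄                             ≈⟨ App̄≋X ⟩
    X                                  ∎
    where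
    wp≋p̄ : wp ≋ p̄
    wp≋p̄ = quot-X-unique wpAp≋X App̄≋X p̄₀≈0

  compose-inverse : ∀ {g ḡ u ū} → compose g ḡ ≋ X → compose u ū ≋ X →
    ḡ 0 ≈ 0# → u 0 ≈ 0# → ū 0 ≈ 0# → compose (compose g u) (compose ū ḡ) ≋ X
  compose-inverse {g} {ḡ} {u} {ū} gḡ≋X uū≋X ḡ₀≈0 u₀≈0 ū₀≈0 = begin
    compose (compose g u) (compose ū ḡ)  ≈⟨ compose-assoc g u _ u₀≈0 (compose-0≈0 ū ḡ ū₀≈0) ⟨
    compose g (compose u (compose ū ḡ))  ≈⟨ compose-congʳ g (compose-assoc u ū ḡ ū₀≈0 ḡ₀≈0) ⟩
    compose g (compose (compose u ū) ḡ)  ≈⟨ compose-congʳ g (compose-congˡ ḡ uū≋X) ⟩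
    compose g (compose X ḡ)              ≈⟨ compose-congʳ g (X-compose ḡ ḡ₀≈0) ⟩
    compose g ḡ                          ≈⟨ gḡ≋X ⟩
    X                                    ∎

  inverse-cong⇔ : ∀ {l a b r} → compose l a ≋ X → compose b r ≋ X → a 0 ≈ 0# → r 0 ≈ 0# →
    (a ≋ b ⇔ l ≋ r)
  inverse-cong⇔ {l} {a} {b} {r} la≋X br≋X a₀≈0 r₀≈0 = mk⇔ to from
    where
    to : a ≋ b → l ≋ r
    to a≋b = begin
      l                        ≈⟨ compose-X l ⟨
      compose l X              ≈⟨ compose-congʳ l br≋X ⟨
      compose l (compose b r)  ≈⟨ compose-congʳ l (compose-congˡ r a≋b) ⟨
      compose l (compose a r)  ≈⟨ compose-assoc l a r a₀≈0 r₀≈0 ⟩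
      compose (compose l a) r  ≈⟨ compose-congˡ r la≋X ⟩
      compose X r              ≈⟨ X-compose r r₀≈0 ⟩
      r                        ∎
    from : l ≋ r → a ≋ b
    from l≋r = begin
      a                        ≈⟨ X-compose a a₀≈0 ⟨
      compose X a              ≈⟨ compose-congˡ a br≋X ⟨
      compose (compose b r) a  ≈⟨ compose-assoc b r a r₀≈0 a₀≈0 ⟨
      compose b (compose r a)  ≈⟨ compose-congʳ b (compose-congˡ a l≋r) ⟨
      compose b (compose l a)  ≈⟨ compose-congʳ b la≋X ⟩
      compose b X              ≈⟨ compose-X b ⟩
      b                        ∎

corollary2p3 : ∀ {c ℓ} (K : CommutativeRing c ℓ) → IsField K →
    let open FPS K in
    (h f : Series) → Order1 h → Order1 f →
    (h̄ f̄ : Series) → IsCompInv h h̄ → IsCompInv f f̄ →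
    (Aₕ A_f : Series) → IsQuot Aₕ X h̄ → IsQuot A_f X f̄ →
    (wf wh : Series) → IsQuot wf X A_f → IsQuot wh X Aₕ →
    ((compose h f ≋ compose f h) ⇔ (A_f · compose Aₕ wf ≋ Aₕ · compose A_f wh))
    × (((compose h f ≋ compose f h) × (compose f h ≋ X))
    ⇔ ((A_f · compose Aₕ wf ≋ Aₕ · compose A_f wh) × (Aₕ · compose A_f wh ≋ one)))
corollary2p3 K _ h f (h₀≈0 , _) (f₀≈0 , _) h̄ f̄ ((h̄₀≈0 , _) , hh̄≋X , h̄h≋X) ((f̄₀≈0 , _) , ff̄≋X , f̄f≋X)
             Aₕ A_f Aₕh̄≋X A_ff̄≋X wf wh wfA_f≋X whAₕ≋X = commute⇔ , identity⇔
  where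
  open CommutativeRing K using (refl)
  open FPS K
  open SeriesRing K
  open Composition K
  open Inversion K
  open Equivalence

  L R : Series
  L = A_f · compose Aₕ wf
  R = Aₕ · compose A_f wh

  L-quot : IsQuot L X (compose h̄ f̄)
  L-quot = quot-X-compose A_ff̄≋X Aₕh̄≋X wfA_f≋X f̄₀≈0

  R-quot : IsQuot R X (compose f̄ h̄)
  R-quot = quot-X-compose Aₕh̄≋X A_ff̄≋X whAₕ≋X h̄₀≈0

  h̄f̄-fh≋X : compose (compose h̄ f̄) (compose f h) ≋ X
  h̄f̄-fh≋X = compose-inverse h̄h≋X f̄f≋X h₀≈0 f̄₀≈0 f₀≈0

  hf-f̄h̄≋X : compose (compose h f) (compose f̄ h̄) ≋ X
  hf-f̄h̄≋X = compose-inverse hh̄≋X ff̄≋X h̄₀≈0 f₀≈0 f̄₀≈0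

  commute⇔ : (compose h f ≋ compose f h) ⇔ (L ≋ R)
  commute⇔ = ⇔.trans (mk⇔ ≋-sym ≋-sym) (⇔.trans
    (inverse-cong⇔ h̄f̄-fh≋X hf-f̄h̄≋X (compose-0≈0 f h f₀≈0) (compose-0≈0 f̄ h̄ f̄₀≈0))
    (⇔.sym (quot-X-cong⇔ L-quot R-quot (compose-0≈0 h̄ f̄ h̄₀≈0))))

  hf≋X⇔R≋one : (compose h f ≋ X) ⇔ (R ≋ one)
  hf≋X⇔R≋one = ⇔.trans
    (⇔.sym (inverse-cong⇔ hf-f̄h̄≋X (compose-X X) (compose-0≈0 f̄ h̄ f̄₀≈0) refl))
    (⇔.sym (quot-X-cong⇔ R-quot (·-identityˡ X) (compose-0≈0 f̄ h̄ f̄₀≈0)))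

  identity⇔ : ((compose h f ≋ compose f h) × (compose f h ≋ X)) ⇔ ((L ≋ R) × (R ≋ one))
  identity⇔ = mk⇔
    (λ (hf≋fh , fh≋X) → to commute⇔ hf≋fh , to hf≋X⇔R≋one (≋-trans hf≋fh fh≋X))
    (λ (L≋R , R≋one) → let hf≋fh = from commute⇔ L≋R in
                        hf≋fh , ≋-trans (≋-sym hf≋fh) (from hf≋X⇔R≋one R≋one))
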